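{- If $G$ is a compound set, then $\langle G\rangle=\langle G(A,B)\rangle$ for some suitable pair $(A,B)$ of $k$-tuples (for some $k\in\mathbb{N}_0$) with $a_i,b_i\ge2$ for all $i$.
   Context: For $k\in\mathbb{N}_0$, a pair $A=(a_1,\dots,a_k)$, $B=(b_1,\dots,b_k)$ of $k$-tuples of positive integers is suitable if $\gcd(a_i,b_j)=1$ for all $i\ge j$. Its compound sequence $G(A,B)=(g_0,\dots,g_k)$ is $g_0=\prod a_i$, $g_i=g_{i-1}b_i/a_i$; for $k=0$ this is $(1)$. A set $G$ of positive integers is compound if its elements can be ordered to form $G(A,B)$ for some suitable pair $(A,B)$. $\langle G\rangle$ is the set of non-negative integer linear combinations of elements of $G$. -}

module Defs where

open import Data.Nat using (ℕ; zero; suc; _*_; _/_; _≤_; _<_)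
open import Data.Nat.Coprimality using (Coprime)
open import Data.Fin using (Fin; toℕ)
open import Data.Vec using (Vec; []; _∷_; lookup; foldr′; sum; zipWith; fromList; toList)
open import Data.List using (List)
open import Data.List.Relation.Unary.Unique.Propositional using (Unique)
open import Data.List.Relation.Binary.Permutation.Propositional using (_↭_)
open import Data.Product using (Σ; _×_)

prodV : {k : ℕ} → Vec ℕ k → ℕ
prodV = foldr′ _*_ 1

-- total natural division; only ever applied with a positive divisor for suitable pairs
divℕ : ℕ → ℕ → ℕ
divℕ m zero    = zero
divℕ m (suc n) = m / suc n

Suitable : {k : ℕ} → Vec ℕ k → Vec ℕ k → Set
Suitable {k} A B =
  ((i : Fin k) → (1 ≤ lookup A i) × (1 ≤ lookup B i)) ×
  ((i j : Fin k) → toℕ j ≤ toℕ i → Coprime (lookup A i) (lookup B j))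

seqFrom : {k : ℕ} → ℕ → Vec ℕ k → Vec ℕ k → Vec ℕ (suc k)
seqFrom g []       []       = g ∷ []
seqFrom g (a ∷ as) (b ∷ bs) = g ∷ seqFrom (divℕ (g * b) a) as bs

compoundSeq : {k : ℕ} → Vec ℕ k → Vec ℕ k → Vec ℕ (suc k)
compoundSeq A B = seqFrom (prodV A) A B

-- a finite set of positive integers, given as a duplicate-free list, is compound
-- if its elements can be ordered to form G(A,B) for a suitable pair
Compound : List ℕ → Set
Compound G = Σ ℕ λ k → Σ (Vec ℕ k) λ A → Σ (Vec ℕ k) λ B →
  Suitable A B × (G ↭ toList (compoundSeq A B))

InSpan : {m : ℕ} → Vec ℕ m → ℕ → Set
InSpan {m} v n = Σ (Vec ℕ m) λ c → sum (zipWith _*_ c v) ≡ n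
  where open import Relation.Binary.PropositionalEquality using (_≡_)

InSpanL : List ℕ → ℕ → Set
InSpanL G n = InSpan (fromList G) n

module Submission where

-- Writing g_i = c · b_1 ⋯ b_i · a_{i+1} ⋯ a_k (c = 1 for G(A,B)), a unit
-- entry makes one generator a multiple of a neighbour, hence redundant:
--   * b_1 = 1 gives g_0 = a_1 g_1, so g_0 and the pair (a_1 , b_1) can go;
--   * a_1 = 1 gives g_1 = b_1 g_0, and dropping g_1 merges b_1 into b_2;
--   * b_2 = 1 gives g_1 = a_2 g_2, and dropping g_1 merges a_2 into a_1.
-- Merging keeps the pair suitable, since a product of integers coprime to x
-- is coprime to x.  Scanning from the left, either all entries are ≥ 2 or
-- one of these moves shortens the pair; induction on k finishes the proof.

open import Defs
open import Data.Nat using (ℕ; _≤_)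
open import Data.Fin using (Fin)
open import Data.Vec using (Vec; lookup)
open import Data.List using (List)
open import Data.List.Relation.Unary.Unique.Propositional using (Unique)
open import Data.Product using (Σ; _×_)
open import Function.Bundles using (_⇔_)

open import Data.Nat using (zero; suc; _+_; _*_; _≟_; z≤n; s≤s)
open import Data.Nat.Properties
  using (*-identityˡ; *-identityʳ; *-assoc; *-comm; *-zeroʳ; +-identityʳ; *-mono-≤; ≤∧≢⇒<)
open import Data.Nat.Divisibility using (_∣_; ∣-trans)
open import Data.Nat.Coprimality using (Coprime; coprime-divisor)
import Data.Nat.Coprimality as Coprime
open import Data.Nat.DivMod using (m*n/n≡m)
open import Data.Nat.Solver using (module +-*-Solver)
open import Data.Fin using (zero; suc; toℕ)
open import Data.Vec using ([]; _∷_; toList; fromList)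
open import Data.Vec.Properties using (toList∘fromList)
open import Data.Vec.Relation.Unary.All using (All; []; _∷_)
import Data.Vec.Relation.Unary.All as All
open import Data.Vec.Relation.Unary.All.Properties using (lookup⁺; lookup⁻)
open import Data.List using ([]; _∷_)
open import Data.List.Relation.Binary.Permutation.Propositional
  using (_↭_; refl; prep; swap; trans; ↭-sym)
open import Data.Product using (_,_; proj₁; proj₂; uncurry)
open import Data.Sum using (_⊎_; inj₁; inj₂)
open import Data.Unit using (⊤; tt)
open import Function using (_∘_)
open import Function.Bundles using (mk⇔; Equivalence)
import Function.Properties.Equivalence as ⇔
open import Relation.Nullary using (yes; no)
open import Level using (0ℓ)
open import Relation.Binary.Bundles using (Setoid)
open import Relation.Binary.PropositionalEquality
  using (_≡_; _≢_; refl; sym; cong; cong₂; subst)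
  renaming (trans to ≡-trans)

open +-*-Solver using (solve; _:=_; _:+_; _:*_; con)

private
  variable
    k : ℕ

infix 4 _∈⟨_⟩ _≋_

_∈⟨_⟩ : ℕ → List ℕ → Set
n ∈⟨ [] ⟩     = n ≡ 0
n ∈⟨ x ∷ L ⟩ = Σ ℕ λ c → Σ ℕ λ m → m ∈⟨ L ⟩ × n ≡ c * x + m

_≋_ : List ℕ → List ℕ → Set
L ≋ L' = ∀ n → n ∈⟨ L ⟩ ⇔ n ∈⟨ L' ⟩

≋-setoid : Setoid 0ℓ 0ℓ
≋-setoid = record
  { Carrier       = List ℕ
  ; _≈_           = _≋_
  ; isEquivalence = record
    { refl  = λ n → ⇔.refl
    ; sym   = λ e n → ⇔.sym (e n)
    ; trans = λ e f n → ⇔.trans (e n) (f n)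
    }
  }

open Setoid ≋-setoid using () renaming (refl to ≋-refl; trans to ≋-trans)
open import Relation.Binary.Reasoning.Setoid ≋-setoid

0∈⟨⟩ : ∀ L → 0 ∈⟨ L ⟩
0∈⟨⟩ []      = refl
0∈⟨⟩ (x ∷ L) = 0 , 0 , 0∈⟨⟩ L , refl

+-closed : ∀ L {m n} → m ∈⟨ L ⟩ → n ∈⟨ L ⟩ → m + n ∈⟨ L ⟩
+-closed []      refl refl = refl
+-closed (x ∷ L) (c , m , m∈L , refl) (d , n , n∈L , refl) =
  c + d , m + n , +-closed L m∈L n∈L ,
  solve 5 (λ c d x m n → c :* x :+ m :+ (d :* x :+ n) := (c :+ d) :* x :+ (m :+ n))
          refl c d x m n

*-closed : ∀ L a {n} → n ∈⟨ L ⟩ → a * n ∈⟨ L ⟩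
*-closed []      a refl = *-zeroʳ a
*-closed (x ∷ L) a (c , m , m∈L , refl) =
  a * c , a * m , *-closed L a m∈L ,
  solve 4 (λ a c x m → a :* (c :* x :+ m) := a :* c :* x :+ a :* m) refl a c x m

redundant : ∀ {x L} → x ∈⟨ L ⟩ → x ∷ L ≋ L
redundant {x} {L} x∈L n = mk⇔
  (λ { (c , m , m∈L , refl) → +-closed L (*-closed L c x∈L) m∈L })
  (λ n∈L → 0 , n , n∈L , refl)

drop-multiple-of-next : ∀ {x y} a L → x ≡ a * y → x ∷ y ∷ L ≋ y ∷ L
drop-multiple-of-next {y = y} a L refl =
  redundant (a , 0 , 0∈⟨⟩ L , sym (+-identityʳ (a * y)))

swap-∈⟨⟩ : ∀ {x y L n} → n ∈⟨ x ∷ y ∷ L ⟩ → n ∈⟨ y ∷ x ∷ L ⟩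
swap-∈⟨⟩ {x} {y} (c , _ , (d , m , m∈L , refl) , refl) =
  d , c * x + m , (c , m , m∈L , refl) ,
  solve 5 (λ c x d y m → c :* x :+ (d :* y :+ m) := d :* y :+ (c :* x :+ m))
          refl c x d y m

↭-∈⟨⟩ : ∀ {L L' n} → L ↭ L' → n ∈⟨ L ⟩ → n ∈⟨ L' ⟩
↭-∈⟨⟩ refl         n∈L = n∈L
↭-∈⟨⟩ (prep x p)   (c , m , m∈L , eq) = c , m , ↭-∈⟨⟩ p m∈L , eq
↭-∈⟨⟩ (swap x y p) (c , m , (d , m' , m'∈L , eq') , eq) =
  swap-∈⟨⟩ (c , m , (d , m' , ↭-∈⟨⟩ p m'∈L , eq') , eq)
↭-∈⟨⟩ (trans p q)  n∈L = ↭-∈⟨⟩ q (↭-∈⟨⟩ p n∈L)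

↭⇒≋ : ∀ {L L'} → L ↭ L' → L ≋ L'
↭⇒≋ p n = mk⇔ (↭-∈⟨⟩ p) (↭-∈⟨⟩ (↭-sym p))

drop-multiple-of-previous : ∀ {x y} b L → y ≡ b * x → x ∷ y ∷ L ≋ x ∷ L
drop-multiple-of-previous {x} {y} b L y≡bx = begin
  x ∷ y ∷ L  ≈⟨ ↭⇒≋ (swap x y refl) ⟩
  y ∷ x ∷ L  ≈⟨ drop-multiple-of-next b L y≡bx ⟩
  x ∷ L      ∎

∷-cong : ∀ x {L L'} → L ≋ L' → x ∷ L ≋ x ∷ L'
∷-cong x e n = mk⇔
  (λ { (c , m , m∈L , eq) → c , m , Equivalence.to   (e m) m∈L , eq })
  (λ { (c , m , m∈L , eq) → c , m , Equivalence.from (e m) m∈L , eq })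

inSpan⇔∈⟨⟩ : ∀ {m} (v : Vec ℕ m) n → InSpan v n ⇔ n ∈⟨ toList v ⟩
inSpan⇔∈⟨⟩ v n = mk⇔ (to v) (from v)
  where
  to : ∀ {m} (v : Vec ℕ m) {n} → InSpan v n → n ∈⟨ toList v ⟩
  to []      ([] , eq)     = sym eq
  to (x ∷ v) (c ∷ cs , eq) = c , _ , to v (cs , refl) , sym eq
  from : ∀ {m} (v : Vec ℕ m) {n} → n ∈⟨ toList v ⟩ → InSpan v n
  from []      eq                   = [] , sym eq
  from (x ∷ v) (c , m , m∈v , refl) with from v m∈v
  ... | cs , refl = c ∷ cs , refl

≋⇒inSpan⇔ : ∀ {m m'} (v : Vec ℕ m) (w : Vec ℕ m') → toList v ≋ toList w →
            ∀ n → InSpan v n ⇔ InSpan w n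
≋⇒inSpan⇔ v w e n =
  ⇔.trans (inSpan⇔∈⟨⟩ v n) (⇔.trans (e n) (⇔.sym (inSpan⇔∈⟨⟩ w n)))

coprime-*ˡ : ∀ {a a' x} → Coprime a x → Coprime a' x → Coprime (a * a') x
coprime-*ˡ {a} {a'} {x} a⊥x a'⊥x {d} (d∣aa' , d∣x) = a⊥x (d∣a , d∣x)
  where
  d⊥a' : Coprime d a'
  d⊥a' (e∣d , e∣a') = a'⊥x (e∣a' , ∣-trans e∣d d∣x)
  d∣a : d ∣ a
  d∣a = coprime-divisor d⊥a' (subst (d ∣_) (*-comm a a') d∣aa')

coprime-*ʳ : ∀ {x b b'} → Coprime x b → Coprime x b' → Coprime x (b * b')
coprime-*ʳ x⊥b x⊥b' = Coprime.sym (coprime-*ˡ (Coprime.sym x⊥b) (Coprime.sym x⊥b'))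

CoprimeTo : ℕ → Vec ℕ k → Set
CoprimeTo x = All (λ a → Coprime a x)

Suitable′ : Vec ℕ k → Vec ℕ k → Set
Suitable′ []       []       = ⊤
Suitable′ (a ∷ as) (b ∷ bs) = 1 ≤ a × 1 ≤ b × CoprimeTo b (a ∷ as) × Suitable′ as bs

suitable⇒suitable′ : (A B : Vec ℕ k) → Suitable A B → Suitable′ A B
suitable⇒suitable′ []       []       _           = tt
suitable⇒suitable′ (a ∷ as) (b ∷ bs) (pos , cop) =
  proj₁ (pos zero) , proj₂ (pos zero) , lookup⁻ (λ i → cop i zero z≤n) ,
  suitable⇒suitable′ as bs ((pos ∘ suc) , (λ i j j≤i → cop (suc i) (suc j) (s≤s j≤i)))

suitable′⇒suitable : (A B : Vec ℕ k) → Suitable′ A B → Suitable A B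
suitable′⇒suitable []       []       _                     = (λ ()) , (λ ())
suitable′⇒suitable (a ∷ as) (b ∷ bs) (1≤a , 1≤b , b⊥A , s) = pos , cop
  where
  pos : ∀ i → (1 ≤ lookup (a ∷ as) i) × (1 ≤ lookup (b ∷ bs) i)
  pos zero    = 1≤a , 1≤b
  pos (suc i) = proj₁ (suitable′⇒suitable as bs s) i
  cop : ∀ i j → toℕ j ≤ toℕ i → Coprime (lookup (a ∷ as) i) (lookup (b ∷ bs) j)
  cop i       zero    _         = lookup⁺ b⊥A i
  cop (suc i) (suc j) (s≤s j≤i) = proj₂ (suitable′⇒suitable as bs s) i j j≤i

-- Closed form of the sequence with an extra factor c:
-- seqList c A B = (c a_1⋯a_k , c b_1 a_2⋯a_k , … , c b_1⋯b_k).
seqList     : ℕ → Vec ℕ k → Vec ℕ k → List ℕ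
laterTerms  : ℕ → Vec ℕ k → Vec ℕ k → List ℕ
seqList c A B = c * prodV A ∷ laterTerms c A B
laterTerms c []       []       = []
laterTerms c (a ∷ as) (b ∷ bs) = seqList (c * b) as bs

-- With positive a_i the divisions in seqFrom are exact, giving the closed form.
seqFrom≡seqList : ∀ c (A B : Vec ℕ k) → All (1 ≤_) A →
                  toList (seqFrom (c * prodV A) A B) ≡ seqList c A B
seqFrom≡seqList c []            []       []              = refl
seqFrom≡seqList c (suc a ∷ as) (b ∷ bs) (s≤s z≤n ∷ pos) =
  cong (c * prodV (suc a ∷ as) ∷_)
       (≡-trans (cong (λ g → toList (seqFrom g as bs)) exact) (seqFrom≡seqList (c * b) as bs pos))
  where
  P = prodV as
  exact : divℕ (c * (suc a * P) * b) (suc a) ≡ c * b * P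
  exact = ≡-trans (cong (λ x → divℕ x (suc a))
                        (solve 4 (λ c a P b → c :* (a :* P) :* b := c :* b :* P :* a) refl c (suc a) P b))
                  (m*n/n≡m (c * b * P) (suc a))

compoundSeq≡seqList : (A B : Vec ℕ k) → Suitable A B → toList (compoundSeq A B) ≡ seqList 1 A B
compoundSeq≡seqList A B (pos , _) =
  ≡-trans (cong (λ g → toList (seqFrom g A B)) (sym (*-identityˡ (prodV A))))
          (seqFrom≡seqList 1 A B (lookup⁻ (proj₁ ∘ pos)))

seqList-cong : ∀ c {k'} (A : Vec ℕ k) (A' : Vec ℕ k') {B B'} → prodV A ≡ prodV A' →
               laterTerms c A B ≋ laterTerms c A' B' → seqList c A B ≋ seqList c A' B'
seqList-cong c A A' {B} {B'} same-head e = begin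
  c * prodV A  ∷ laterTerms c A B  ≡⟨ cong (λ u → c * u ∷ laterTerms c A B) same-head ⟩
  c * prodV A' ∷ laterTerms c A B  ≈⟨ ∷-cong _ e ⟩
  c * prodV A' ∷ laterTerms c A' B' ∎

-- Move 1: if b_1 = 1 then g_0 = a_1 g_1, so g_0 is redundant.
drop-unit-b : ∀ c a (as bs : Vec ℕ k) → seqList c (a ∷ as) (1 ∷ bs) ≋ seqList c as bs
drop-unit-b c a as bs = begin
  c * (a * P) ∷ seqList (c * 1) as bs  ≡⟨ cong (λ d → c * (a * P) ∷ seqList d as bs) (*-identityʳ c) ⟩
  c * (a * P) ∷ seqList c as bs        ≈⟨ drop-multiple-of-next a (laterTerms c as bs) g₀≡a₁g₁ ⟩
  seqList c as bs                      ∎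
  where
  P = prodV as
  g₀≡a₁g₁ : c * (a * P) ≡ a * (c * P)
  g₀≡a₁g₁ = solve 3 (λ c a P → c :* (a :* P) := a :* (c :* P)) refl c a P

-- Move 2: if a_1 = 1 then g_1 = b_1 g_0, so g_1 is redundant; b_1 merges into b_2.
drop-unit-a-last : ∀ c b → seqList c (1 ∷ []) (b ∷ []) ≋ seqList c [] []
drop-unit-a-last c b =
  drop-multiple-of-previous b [] (solve 2 (λ c b → c :* b :* con 1 := b :* (c :* con 1)) refl c b)

merge-unit-a : ∀ c b b' a' (as bs : Vec ℕ k) →
               seqList c (1 ∷ a' ∷ as) (b ∷ b' ∷ bs) ≋ seqList c (a' ∷ as) (b * b' ∷ bs)
merge-unit-a c b b' a' as bs = begin
  c * (1 * Q) ∷ c * b * Q ∷ seqList (c * b * b') as bs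
    ≡⟨ cong₂ (λ u d → c * u ∷ c * b * Q ∷ seqList d as bs) (*-identityˡ Q) (*-assoc c b b') ⟩
  c * Q ∷ c * b * Q ∷ seqList (c * (b * b')) as bs
    ≈⟨ drop-multiple-of-previous b _ g₁≡b₁g₀ ⟩
  c * Q ∷ seqList (c * (b * b')) as bs ∎
  where
  Q = a' * prodV as
  g₁≡b₁g₀ : c * b * Q ≡ b * (c * Q)
  g₁≡b₁g₀ = solve 3 (λ c b Q → c :* b :* Q := b :* (c :* Q)) refl c b Q

-- Move 3: if b_2 = 1 then g_1 = a_2 g_2, so g_1 is redundant; a_2 merges into a_1.
merge-unit-b₂ : ∀ c a a' b (as bs : Vec ℕ k) →
                seqList c (a ∷ a' ∷ as) (b ∷ 1 ∷ bs) ≋ seqList c (a * a' ∷ as) (b ∷ bs)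
merge-unit-b₂ c a a' b as bs =
  seqList-cong c (a ∷ a' ∷ as) (a * a' ∷ as) (sym (*-assoc a a' (prodV as)))
    (drop-unit-b (c * b) a' as bs)

record Shortening (c : ℕ) {m} (A B : Vec ℕ (suc m)) : Set where
  constructor shortening
  field
    A′ B′         : Vec ℕ m
    suitable      : Suitable′ A′ B′
    same-product  : prodV A ≡ prodV A′
    keeps-coprime : ∀ {x} → CoprimeTo x A → CoprimeTo x A′
    same-span     : seqList c A B ≋ seqList c A′ B′

-- Moves 2 and 3 shorten a suitable pair: merged entries stay coprime to
-- the relevant b's (resp. a's) because coprimality to x is closed under products.
shorten-unit-a-last : ∀ c b → Shortening c (1 ∷ []) (b ∷ [])
shorten-unit-a-last c b = shortening [] [] tt refl (λ _ → []) (drop-unit-a-last c b)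

shorten-unit-a : ∀ c {a' b b'} {as bs : Vec ℕ k} → Suitable′ (1 ∷ a' ∷ as) (b ∷ b' ∷ bs) →
                 Shortening c (1 ∷ a' ∷ as) (b ∷ b' ∷ bs)
shorten-unit-a c {a'} {b} {b'} {as} {bs} (_ , 1≤b , _ ∷ A⊥b , 1≤a' , 1≤b' , A⊥b' , s) =
  shortening (a' ∷ as) (b * b' ∷ bs)
    (1≤a' , *-mono-≤ 1≤b 1≤b' , All.map (uncurry coprime-*ʳ) (All.zip (A⊥b , A⊥b')) , s)
    (*-identityˡ (a' * prodV as)) All.tail (merge-unit-a c b b' a' as bs)

shorten-unit-b₂ : ∀ c {a a' b} {as bs : Vec ℕ k} → Suitable′ (a ∷ a' ∷ as) (b ∷ 1 ∷ bs) →
                  Shortening c (a ∷ a' ∷ as) (b ∷ 1 ∷ bs)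
shorten-unit-b₂ c {a} {a'} {b} {as} {bs} (1≤a , 1≤b , a⊥b ∷ a'⊥b ∷ as⊥b , 1≤a' , _ , _ , s) =
  shortening (a * a' ∷ as) (b ∷ bs)
    (*-mono-≤ 1≤a 1≤a' , 1≤b , coprime-*ˡ a⊥b a'⊥b ∷ as⊥b , s)
    (sym (*-assoc a a' (prodV as))) merge (merge-unit-b₂ c a a' b as bs)
  where
  merge : ∀ {x} → CoprimeTo x (a ∷ a' ∷ as) → CoprimeTo x (a * a' ∷ as)
  merge (a⊥x ∷ a'⊥x ∷ as⊥x) = coprime-*ˡ a⊥x a'⊥x ∷ as⊥x

shorten-tail : ∀ {c a b m} {A B : Vec ℕ (suc m)} → Suitable′ (a ∷ A) (b ∷ B) →
               Shortening (c * b) A B → Shortening c (a ∷ A) (b ∷ B)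
shorten-tail {c} {a} {b} {A = A} (1≤a , 1≤b , a⊥b ∷ A⊥b , _) (shortening A′ B′ s′ p keep e) =
  shortening (a ∷ A′) (b ∷ B′) (1≤a , 1≤b , a⊥b ∷ keep A⊥b , s′) (cong (a *_) p)
    (λ { (a⊥x ∷ A⊥x) → a⊥x ∷ keep A⊥x }) (seqList-cong c (a ∷ A) (a ∷ A′) (cong (a *_) p) e)

AtLeast2 : Vec ℕ k → Vec ℕ k → Set
AtLeast2 A B = All (2 ≤_) A × All (2 ≤_) B

≢1⇒≥2 : ∀ {a} → 1 ≤ a → a ≢ 1 → 2 ≤ a
≢1⇒≥2 1≤a a≢1 = ≤∧≢⇒< 1≤a (a≢1 ∘ sym)

-- Scanning from the left when b_1 ≥ 2: either every entry is ≥ 2, or a_i = 1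
-- or b_{i+1} = 1 at the first place i where this fails, and Move 2 or 3 applies.
shorten : ∀ {m} c a b (as bs : Vec ℕ m) → Suitable′ (a ∷ as) (b ∷ bs) → 2 ≤ b →
          AtLeast2 (a ∷ as) (b ∷ bs) ⊎ Shortening c (a ∷ as) (b ∷ bs)
shorten c a b [] [] (1≤a , _) 2≤b with a ≟ 1
... | yes refl = inj₂ (shorten-unit-a-last c b)
... | no a≢1   = inj₁ (≢1⇒≥2 1≤a a≢1 ∷ [] , 2≤b ∷ [])
shorten c a b (a' ∷ as) (b' ∷ bs) s@(1≤a , _ , _ , s'@(_ , 1≤b' , _)) 2≤b with a ≟ 1 | b' ≟ 1
... | yes refl | _        = inj₂ (shorten-unit-a c s)
... | no _      | yes refl = inj₂ (shorten-unit-b₂ c s)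
... | no a≢1    | no b'≢1  with shorten (c * b) a' b' as bs s' (≢1⇒≥2 1≤b' b'≢1)
...   | inj₁ (as≥2 , bs≥2) = inj₁ (≢1⇒≥2 1≤a a≢1 ∷ as≥2 , 2≤b ∷ bs≥2)
...   | inj₂ tail-shortened = inj₂ (shorten-tail s tail-shortened)

record Reduced (c : ℕ) (A B : Vec ℕ k) : Set where
  constructor reduced
  field
    {k′}       : ℕ
    A′ B′      : Vec ℕ k′
    suitable   : Suitable′ A′ B′
    at-least-2 : AtLeast2 A′ B′
    same-span  : seqList c A B ≋ seqList c A′ B′

reduced-≋ : ∀ {c k₁} {A B : Vec ℕ k} {A₁ B₁ : Vec ℕ k₁} →
            seqList c A B ≋ seqList c A₁ B₁ → Reduced c A₁ B₁ → Reduced c A B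
reduced-≋ e (reduced A′ B′ s ≥2 e′) = reduced A′ B′ s ≥2 (≋-trans e e′)

reduce : ∀ k c (A B : Vec ℕ k) → Suitable′ A B → Reduced c A B
reduce zero    c []       []       _ = reduced [] [] tt ([] , []) ≋-refl
reduce (suc m) c (a ∷ as) (b ∷ bs) s@(_ , 1≤b , _ , s') with b ≟ 1
... | yes refl = reduced-≋ (drop-unit-b c a as bs) (reduce m c as bs s')
... | no b≢1   with shorten c a b as bs s (≢1⇒≥2 1≤b b≢1)
...   | inj₁ ≥2 = reduced (a ∷ as) (b ∷ bs) s ≥2 ≋-refl
...   | inj₂ (shortening A′ B′ s′ _ _ e) = reduced-≋ e (reduce m c A′ B′ s′)

proposition2p9 : (G : List ℕ) → Unique G → Compound G →
    Σ ℕ λ k → Σ (Vec ℕ k) λ A → Σ (Vec ℕ k) λ B →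
      Suitable A B ×
      ((i : Fin k) → (2 ≤ lookup A i) × (2 ≤ lookup B i)) ×
      ((n : ℕ) → InSpanL G n ⇔ InSpan (compoundSeq A B) n)
proposition2p9 G _ (k , A , B , suitable , G↭G[A,B])
  with reduce k 1 A B (suitable⇒suitable′ A B suitable)
... | reduced {k'} A' B' suitable' (A'≥2 , B'≥2) same-span =
  k' , A' , B' , suitable′⇒suitable A' B' suitable' ,
  (λ i → lookup⁺ A'≥2 i , lookup⁺ B'≥2 i) ,
  ≋⇒inSpan⇔ (fromList G) (compoundSeq A' B') (begin
    toList (fromList G)        ≡⟨ toList∘fromList G ⟩
    G                          ≈⟨ ↭⇒≋ G↭G[A,B] ⟩
    toList (compoundSeq A B)   ≡⟨ compoundSeq≡seqList A B suitable ⟩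
    seqList 1 A B              ≈⟨ same-span ⟩
    seqList 1 A' B'            ≡⟨ compoundSeq≡seqList A' B' (suitable′⇒suitable A' B' suitable') ⟨
    toList (compoundSeq A' B') ∎)
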